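{- Let $X=X_2=\{\circ,\bullet\}$. The six sets of tree patterns whose complements in $\mathcal{LT}_3(X)$ are $\{\circ(\circ(1,2),3),\circ(\circ(1,3),2)\}$, $\{\circ(\circ(1,3),2),\circ(1,\circ(2,3))\}$, $\{\circ(\circ(1,2),3),\circ(1,\circ(2,3))\}$, $\{\bullet(\bullet(1,2),3),\bullet(\bullet(1,3),2)\}$, $\{\bullet(\bullet(1,3),2),\bullet(1,\bullet(2,3))\}$, $\{\bullet(\bullet(1,2),3),\bullet(1,\bullet(2,3))\}$ are Wilf equivalent to each other; for each $n\ge4$, the number of trees with $n$ leaves avoiding any one of these sets is $(n-1)!$.
   Context: Trees are planar rooted binary trees whose internal vertices are each labelled $\circ$ or $\bullet$ and whose leaves are labelled bijectively by $\{1,\dots,l\}$ so that, assigning to each internal vertex the minimum label of its descendant leaves, the left child of each internal vertex has a smaller assigned number than its right child. Notation: a leaf is its label, and $c(A,B)$ denotes the tree whose root is labelled $c\in\{\circ,\bullet\}$ with left subtree $A$ and right subtree $B$. $\mathcal{LT}_3(X)$ is the set of the $12$ such trees with three leaves. A subtree of $T$ is a subtree $S$ rooted at an internal vertex of $T$ such that for every internal vertex of $S$ both its children in $T$ are in $S$; its leaves carry the assigned integers and relabelling them order-preservingly by $1,\dots,l$ gives the standardisation $\mathrm{st}(S)$; $T$ avoids a set of patterns if no $\mathrm{st}(S)$ lies in the set. Two pattern sets are Wilf equivalent if for every $l$ the numbers of trees with $l$ leaves avoiding them coincide. -}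

module Defs where

open import Data.Bool using (Bool; true; false; _∧_; _∨_; not; if_then_else_; T)
open import Data.Nat using (_≤?_; ℕ; zero; suc; _+_; _∸_; _≤_; _<ᵇ_; _≤ᵇ_; _≡ᵇ_; _⊓_)
open import Data.List using (List; []; _∷_; _++_; map; concatMap; length; filter)
open import Data.Bool.ListAction using (any; all)
open import Data.List.Base using (upTo)
open import Data.Product using (Σ; _×_; _,_; ∃)
import Data.Fin as Fin
open Fin using (Fin)
open import Function.Bundles using (_↔_)

data Col : Set where
  ∘ • : Col

_==ᶜ_ : Col → Col → Bool
∘ ==ᶜ ∘ = true
• ==ᶜ • = true
_ ==ᶜ _ = false

data Tree : Set where
  leaf : ℕ → Tree
  node : Col → Tree → Tree → Tree

_==ᵗ_ : Tree → Tree → Bool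
leaf i ==ᵗ leaf j = i ≡ᵇ j
node c A B ==ᵗ node d C D = (c ==ᶜ d) ∧ ((A ==ᵗ C) ∧ (B ==ᵗ D))
_ ==ᵗ _ = false

leaves : Tree → List ℕ
leaves (leaf i) = i ∷ []
leaves (node _ A B) = leaves A ++ leaves B

-- the number assigned to a vertex: minimum label of its descendant leaves
minLabel : Tree → ℕ
minLabel (leaf i) = i
minLabel (node _ A B) = minLabel A ⊓ minLabel B

elemᵇ : ℕ → List ℕ → Bool
elemᵇ x xs = any (λ y → x ≡ᵇ y) xs

labelsAre : ℕ → Tree → Bool
labelsAre l t = (length (leaves t) ≡ᵇ l) ∧ all (λ i → elemᵇ (suc i) (leaves t)) (upTo l)

minCond : Tree → Bool
minCond (leaf _) = true
minCond (node _ A B) = (minLabel A <ᵇ minLabel B) ∧ (minCond A ∧ minCond B)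

isLT : ℕ → Tree → Bool
isLT l t = labelsAre l t ∧ minCond t

-- All "truncations" of t at its root: connected pieces containing the root in
-- which every vertex has either both of its children or none; a vertex that
-- becomes a leaf of the truncation carries its assigned number (minLabel).
truncations : Tree → List Tree
truncations (leaf i) = leaf i ∷ []
truncations (node c A B) =
  leaf (minLabel (node c A B)) ∷
  concatMap (λ A′ → map (λ B′ → node c A′ B′) (truncations B)) (truncations A)

internalTruncations : Tree → List Tree
internalTruncations (leaf _) = []
internalTruncations (node c A B) =
  concatMap (λ A′ → map (λ B′ → node c A′ B′) (truncations B)) (truncations A)

subtrees : Tree → List Tree
subtrees (leaf _) = []
subtrees (node c A B) = internalTruncations (node c A B) ++ (subtrees A ++ subtrees B)

rank : ℕ → List ℕ → ℕ
rank x xs = length (filter (λ y → y ≤? x) xs)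

relabel : List ℕ → Tree → Tree
relabel xs (leaf i) = leaf (rank i xs)
relabel xs (node c A B) = node c (relabel xs A) (relabel xs B)

st : Tree → Tree
st S = relabel (leaves S) S

PatternSet : Set
PatternSet = Tree → Bool

avoids : PatternSet → Tree → Bool
avoids P t = all (λ S → not (P (st S))) (subtrees t)

Avoiders : PatternSet → ℕ → Set
Avoiders P l = Σ Tree (λ t → T (isLT l t ∧ avoids P t))

HasCount : PatternSet → ℕ → ℕ → Set
HasCount P l k = Fin k ↔ Avoiders P l

WilfEquivalent : PatternSet → PatternSet → Set
WilfEquivalent P Q = ∀ l → ∃ λ k → HasCount P l k × HasCount Q l k

memᵗ : Tree → List Tree → Bool
memᵗ t ts = any (λ s → t ==ᵗ s) ts

complementIn3 : List Tree → PatternSet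
complementIn3 C t = isLT 3 t ∧ not (memᵗ t C)

l1 l2 l3 : Tree
l1 = leaf 1
l2 = leaf 2
l3 = leaf 3

sixSets : Fin 6 → PatternSet
sixSets Fin.zero = complementIn3 (node ∘ (node ∘ l1 l2) l3 ∷ node ∘ (node ∘ l1 l3) l2 ∷ [])
sixSets (Fin.suc Fin.zero) = complementIn3 (node ∘ (node ∘ l1 l3) l2 ∷ node ∘ l1 (node ∘ l2 l3) ∷ [])
sixSets (Fin.suc (Fin.suc Fin.zero)) = complementIn3 (node ∘ (node ∘ l1 l2) l3 ∷ node ∘ l1 (node ∘ l2 l3) ∷ [])
sixSets (Fin.suc (Fin.suc (Fin.suc Fin.zero))) = complementIn3 (node • (node • l1 l2) l3 ∷ node • (node • l1 l3) l2 ∷ [])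
sixSets (Fin.suc (Fin.suc (Fin.suc (Fin.suc Fin.zero)))) = complementIn3 (node • (node • l1 l3) l2 ∷ node • l1 (node • l2 l3) ∷ [])
sixSets (Fin.suc (Fin.suc (Fin.suc (Fin.suc (Fin.suc Fin.zero))))) = complementIn3 (node • (node • l1 l2) l3 ∷ node • l1 (node • l2 l3) ∷ [])

module Submission where

-- A three-leaf subtree of a tree is a fork: c(d(a₁,a₂),b) or c(a,e(b₁,b₂)) at some internal vertex c(A,B),
-- with leaves the least labels of the subtrees involved. All six pattern sets consist of three-leaf trees,
-- so avoidance is local. If the complement of the i-th set is the pair of κ-coloured forks whose shape is not σ,
-- a tree with at least three leaves avoids it iff every internal vertex has colour κ and no fork standardises
-- to shape σ. Such trees with n+1 leaves arise exactly once by grafting the largest leaf, under a new κ-vertex,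
-- above one of n admissible vertices of such a tree with n leaves, so there are n! of them whatever i is.

open import Defs

open import Data.Bool using (Bool; true; false; _∧_; not; T; if_then_else_)
open import Data.Bool.ListAction using (all)
open import Data.Bool.Properties using (T-∧; T-≡; T-irrelevant; ∧-assoc; ∧-comm; ∧-identityʳ)
open import Data.Empty using (⊥; ⊥-elim)
open import Data.Fin using (Fin)
open import Data.Fin.Patterns using (0F; 1F; 2F; 3F; 4F; 5F)
open import Data.Fin.Properties using (0↔⊥; 1↔⊤; +↔⊎; *↔×)
open import Data.List using (List; []; _∷_; _++_; length; upTo; map; concatMap)
open import Data.List.Membership.Propositional using (_∈_; _∉_)
open import Data.List.Membership.Propositional.Properties using (∈-∃++; ∈-++⁺ˡ; ∈-++⁺ʳ; ∈-++⁻)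
open import Data.List.Properties using (length-++; filter-accept; filter-reject)
open import Data.List.Relation.Binary.Disjoint.Propositional using (Disjoint)
open import Data.List.Relation.Unary.All as All using (All; []; _∷_)
import Data.List.Relation.Unary.All.Properties as All
open import Data.List.Relation.Unary.AllPairs using ([]; _∷_)
open import Data.List.Relation.Unary.Any as Any using (here; there)
import Data.List.Relation.Unary.Any.Properties as Any
open import Data.List.Relation.Unary.Unique.Propositional using (Unique)
open import Data.Nat using (ℕ; zero; suc; _+_; _*_; _∸_; _⊓_; _≤_; _<_; _<ᵇ_; _≡ᵇ_; _≤?_; _!; z≤n; s≤s)
open import Data.Nat.Properties
open import Data.Product using (Σ; _×_; _,_; proj₁; proj₂)
open import Data.Product.Algebra using (×-comm)
open import Data.Product.Function.Dependent.Propositional using (Σ-↔)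
open import Data.Product.Function.NonDependent.Propositional using (_×-↔_)
open import Data.Product.Properties using (Σ-≡,≡←≡)
open import Data.Sum using (_⊎_; inj₁; inj₂)
open import Data.Sum.Function.Propositional using (_⊎-↔_)
open import Data.Unit using (⊤; tt)
open import Function using (id)
open import Function.Bundles using (_↔_; _⇔_; Equivalence; mk↔ₛ′; mk⇔; mk⤖)
open import Function.Consequences.Propositional using (strictlySurjective⇒surjective)
open import Function.Properties.Bijection using (⤖⇒↔)
open import Function.Properties.Inverse using (↔-refl; ↔-sym; ↔-trans)
open import Function.Related.Propositional using (module EquationalReasoning)
open import Relation.Binary using (tri<; tri≈; tri>)
open import Relation.Binary.PropositionalEquality

T-∧⁻ : ∀ {a b} → T (a ∧ b) → T a × T b
T-∧⁻ = Equivalence.to T-∧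

T-∧⁺ : ∀ {a b} → T a → T b → T (a ∧ b)
T-∧⁺ p q = Equivalence.from T-∧ (p , q)

<ᵇ-true : ∀ {m n} → m < n → (m <ᵇ n) ≡ true
<ᵇ-true m<n = Equivalence.to T-≡ (<⇒<ᵇ m<n)

<ᵇ-false : ∀ {m n} → n ≤ m → (m <ᵇ n) ≡ false
<ᵇ-false {m} {n} n≤m with m <ᵇ n in eq
... | false = refl
... | true = ⊥-elim (<⇒≱ (<ᵇ⇒< m n (subst T (sym eq) tt)) n≤m)

size : Tree → ℕ
size (leaf _) = 1
size (node _ A B) = size A + size B

node-injective : ∀ {c c′ A A′ B B′} → node c A B ≡ node c′ A′ B′ → c ≡ c′ × A ≡ A′ × B ≡ B′
node-injective refl = refl , refl , refl

length-leaves : ∀ t → length (leaves t) ≡ size t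
length-leaves (leaf _) = refl
length-leaves (node _ A B) = trans (length-++ (leaves A)) (cong₂ _+_ (length-leaves A) (length-leaves B))

1≤size : ∀ t → 1 ≤ size t
1≤size (leaf _) = s≤s z≤n
1≤size (node _ A B) = ≤-trans (1≤size A) (m≤m+n (size A) (size B))

Labelled : ℕ → Tree → Set
Labelled n t = size t ≡ n × (∀ i → i < n → suc i ∈ leaves t)

elemᵇ⇒∈ : ∀ x xs → T (elemᵇ x xs) → x ∈ xs
elemᵇ⇒∈ x xs p = Any.map (≡ᵇ⇒≡ x _) (Any.any⁻ _ xs p)

∈⇒elemᵇ : ∀ {x xs} → x ∈ xs → T (elemᵇ x xs)
∈⇒elemᵇ {x} x∈xs = Any.any⁺ _ (Any.map (≡⇒≡ᵇ x _) x∈xs)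

labelsAre⇒Labelled : ∀ n t → T (labelsAre n t) → Labelled n t
labelsAre⇒Labelled n t p =
  let len , cover = T-∧⁻ p in
    trans (sym (length-leaves t)) (≡ᵇ⇒≡ _ n len)
  , λ i i<n → elemᵇ⇒∈ (suc i) (leaves t) (All.applyUpTo⁻ id n (All.all⁺ _ (upTo n) cover) i<n)

Labelled⇒labelsAre : ∀ n t → Labelled n t → T (labelsAre n t)
Labelled⇒labelsAre n t (size≡n , cover) =
  T-∧⁺ (≡⇒≡ᵇ _ n (trans (length-leaves t) size≡n))
       (All.all⁻ _ (All.applyUpTo⁺₁ id n (λ {i} i<n → ∈⇒elemᵇ (cover i i<n))))

∈-delete : ∀ {x y : ℕ} ys {zs} → x ∈ ys ++ y ∷ zs → x ≢ y → x ∈ ys ++ zs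
∈-delete [] (here refl) x≢y = ⊥-elim (x≢y refl)
∈-delete [] (there p) _ = p
∈-delete (_ ∷ ys) (here refl) _ = here refl
∈-delete (_ ∷ ys) (there p) x≢y = there (∈-delete ys p x≢y)

All-insert : ∀ {P : ℕ → Set} ys {zs y} → All P (ys ++ zs) → P y → All P (ys ++ y ∷ zs)
All-insert [] ps py = py ∷ ps
All-insert (_ ∷ ys) (px ∷ ps) py = px ∷ All-insert ys ps py

Unique-insert : ∀ ys {zs y} → Unique (ys ++ zs) → All (_≢ y) (ys ++ zs) → Unique (ys ++ y ∷ zs)
Unique-insert [] u fresh = All.map (λ x≢y y≡x → x≢y (sym y≡x)) fresh ∷ u
Unique-insert (_ ∷ ys) (x∉ ∷ u) (x≢y ∷ fresh) = All-insert ys x∉ x≢y ∷ Unique-insert ys u fresh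

length-insert : ∀ (ys : List ℕ) {zs y} → length (ys ++ y ∷ zs) ≡ suc (length (ys ++ zs))
length-insert [] = refl
length-insert (_ ∷ ys) = cong suc (length-insert ys)

cover⇒Unique×bounded : ∀ n xs → length xs ≡ n → (∀ i → i < n → suc i ∈ xs) → Unique xs × All (_≤ n) xs
cover⇒Unique×bounded zero [] _ _ = [] , []
cover⇒Unique×bounded (suc n) xs len cover with ∈-∃++ (cover n ≤-refl)
... | ys , zs , refl with cover⇒Unique×bounded n (ys ++ zs) (suc-injective (trans (sym (length-insert ys)) len))
                            (λ i i<n → ∈-delete ys (cover i (m≤n⇒m≤1+n i<n)) (λ eq → <-irrefl (suc-injective eq) i<n))
... | u , bounded = Unique-insert ys u (All.map (λ x≤n x≡1+n → <-irrefl x≡1+n (s≤s x≤n)) bounded)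
                  , All-insert ys (All.map m≤n⇒m≤1+n bounded) ≤-refl

Labelled⇒Unique×bounded : ∀ {n} t → Labelled n t → Unique (leaves t) × All (_≤ n) (leaves t)
Labelled⇒Unique×bounded {n} t (size≡n , cover) =
  cover⇒Unique×bounded n (leaves t) (trans (length-leaves t) size≡n) cover

minLabel-∈ : ∀ t → minLabel t ∈ leaves t
minLabel-∈ (leaf _) = here refl
minLabel-∈ (node c A B) with ≤-total (minLabel A) (minLabel B)
... | inj₁ A≤B rewrite m≤n⇒m⊓n≡m A≤B = ∈-++⁺ˡ (minLabel-∈ A)
... | inj₂ B≤A rewrite m≥n⇒m⊓n≡n B≤A = ∈-++⁺ʳ (leaves A) (minLabel-∈ B)

minLabel-node : ∀ c A B → minLabel A < minLabel B → minLabel (node c A B) ≡ minLabel A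
minLabel-node c A B A<B = m≤n⇒m⊓n≡m (<⇒≤ A<B)

minCond-node : ∀ {c A B} → T (minCond (node c A B)) → minLabel A < minLabel B × T (minCond A) × T (minCond B)
minCond-node {A = A} {B} mc = let A<B , mcAB = T-∧⁻ mc ; mcA , mcB = T-∧⁻ mcAB in <ᵇ⇒< (minLabel A) _ A<B , mcA , mcB

Unique-++⁻ : ∀ (xs ys : List ℕ) → Unique (xs ++ ys) → Unique xs × Unique ys × Disjoint xs ys
Unique-++⁻ [] _ u = [] , u , λ ()
Unique-++⁻ (x ∷ xs) ys (x∉ ∷ u) with Unique-++⁻ xs ys u
... | uxs , uys , disjoint = All.++⁻ˡ xs x∉ ∷ uxs , uys , disjoint′
  where
  disjoint′ : Disjoint (x ∷ xs) ys
  disjoint′ (here refl , p) = All.lookup (All.++⁻ʳ xs x∉) p refl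
  disjoint′ (there q , p) = disjoint (q , p)

Counted : (Tree → Bool) → ℕ → Set
Counted p n = Σ Tree λ t → T (isLT n t ∧ p t)

isLT∧-elim : ∀ {n b} t → T (isLT n t ∧ b) → Labelled n t × T (minCond t) × T b
isLT∧-elim {n} t pf =
  let lt , b = T-∧⁻ pf ; labels , mc = T-∧⁻ lt in labelsAre⇒Labelled n t labels , mc , b

isLT∧-intro : ∀ {n b} t → Labelled n t → T (minCond t) → T b → T (isLT n t ∧ b)
isLT∧-intro {n} t labelled mc b = T-∧⁺ (T-∧⁺ (Labelled⇒labelsAre n t labelled) mc) b

Counted-≡ : ∀ {p n} {x y : Counted p n} → proj₁ x ≡ proj₁ y → x ≡ y
Counted-≡ {x = t , pf} {.t , pf′} refl = cong (t ,_) (T-irrelevant pf pf′)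

Counted-cong : ∀ {p q n} → (∀ t → T (isLT n t) → T (p t) ⇔ T (q t)) → Counted p n ↔ Counted q n
Counted-cong {p} {q} {n} p⇔q =
  mk↔ₛ′ (transport (λ t lt → Equivalence.to (p⇔q t lt))) (transport (λ t lt → Equivalence.from (p⇔q t lt)))
        (λ _ → Counted-≡ refl) (λ _ → Counted-≡ refl)
  where
  transport : ∀ {p q} → (∀ t → T (isLT n t) → T (p t) → T (q t)) → Counted p n → Counted q n
  transport p⇒q (t , pf) = let lt , pt = T-∧⁻ {isLT n t} pf in t , T-∧⁺ lt (p⇒q t lt pt)

-- Avoiding patterns with three leaves

size-relabel : ∀ xs S → size (relabel xs S) ≡ size S
size-relabel xs (leaf _) = refl
size-relabel xs (node c A B) = cong₂ _+_ (size-relabel xs A) (size-relabel xs B)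

all-++ : ∀ {A : Set} (f : A → Bool) xs ys → all f (xs ++ ys) ≡ all f xs ∧ all f ys
all-++ f [] ys = refl
all-++ f (x ∷ xs) ys = trans (cong (f x ∧_) (all-++ f xs ys)) (sym (∧-assoc (f x) _ _))

joins : Col → List Tree → List Tree → List Tree
joins c xs ys = concatMap (λ a → map (node c a) ys) xs

All-joins : ∀ {P Q R : Tree → Set} c xs ys → All P xs → All Q ys →
            (∀ {a b} → P a → Q b → R (node c a b)) → All R (joins c xs ys)
All-joins c [] ys [] qs pq⇒r = []
All-joins c (x ∷ xs) ys (p ∷ ps) qs pq⇒r =
  All.++⁺ (All.map⁺ (All.map (pq⇒r p) qs)) (All-joins c xs ys ps qs pq⇒r)

truncations≡ : ∀ X → truncations X ≡ leaf (minLabel X) ∷ internalTruncations X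
truncations≡ (leaf _) = refl
truncations≡ (node _ _ _) = refl

truncations-size≥1 : ∀ X → All (λ x → 1 ≤ size x) (truncations X)
truncations-size≥1 X = All.tabulate (λ {x} _ → 1≤size x)

internalTruncations-size≥2 : ∀ X → All (λ x → 2 ≤ size x) (internalTruncations X)
internalTruncations-size≥2 (leaf _) = []
internalTruncations-size≥2 (node c A B) =
  All-joins c (truncations A) (truncations B) (truncations-size≥1 A) (truncations-size≥1 B) +-mono-≤

cherry : Col → Tree → Tree → Tree
cherry d X₁ X₂ = node d (leaf (minLabel X₁)) (leaf (minLabel X₂))

internalTruncations-node : ∀ d X₁ X₂ → Σ (List Tree) λ rest →
  internalTruncations (node d X₁ X₂) ≡ cherry d X₁ X₂ ∷ rest × All (λ x → 3 ≤ size x) rest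
internalTruncations-node d X₁ X₂ =
    map (node d (leaf (minLabel X₁))) (internalTruncations X₂)
      ++ joins d (internalTruncations X₁) (leaf (minLabel X₂) ∷ internalTruncations X₂)
  , eq
  , All.++⁺ (All.map⁺ (All.map s≤s (internalTruncations-size≥2 X₂)))
            (All-joins d _ _ (internalTruncations-size≥2 X₁)
                       (subst (All (λ x → 1 ≤ size x)) (truncations≡ X₂) (truncations-size≥1 X₂)) +-mono-≤)
  where
  eq : internalTruncations (node d X₁ X₂) ≡ _
  eq rewrite truncations≡ X₁ | truncations≡ X₂ = refl

module ThreeLeafPatterns (P : PatternSet) (threeLeaved : ∀ X → size X ≢ 3 → P X ≡ false) where

  allowed : Tree → Bool
  allowed S = not (P (st S))

  allowed-≢3 : ∀ S → size S ≢ 3 → allowed S ≡ true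
  allowed-≢3 S ≢3 rewrite threeLeaved (st S) (λ eq → ≢3 (trans (sym (size-relabel (leaves S) S)) eq)) = refl

  all-allowed-≥4 : ∀ xs → All (λ x → 4 ≤ size x) xs → all allowed xs ≡ true
  all-allowed-≥4 [] [] = refl
  all-allowed-≥4 (x ∷ xs) (≥4 ∷ ps)
    rewrite allowed-≢3 x (λ eq → <-irrefl (sym eq) ≥4) | all-allowed-≥4 xs ps = refl

  leftForkOk : Col → Tree → Tree → Bool
  leftForkOk c (leaf _) B = true
  leftForkOk c (node d A₁ A₂) B = allowed (node c (cherry d A₁ A₂) (leaf (minLabel B)))

  rightForkOk : Col → Tree → Tree → Bool
  rightForkOk c A (leaf _) = true
  rightForkOk c A (node e B₁ B₂) = allowed (node c (leaf (minLabel A)) (cherry e B₁ B₂))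

  forksOk : Tree → Bool
  forksOk (leaf _) = true
  forksOk (node c A B) = leftForkOk c A B ∧ (rightForkOk c A B ∧ (forksOk A ∧ forksOk B))

  private
    truncations′ : Tree → List Tree
    truncations′ B = leaf (minLabel B) ∷ internalTruncations B

    rightTruncations : ∀ c A B → all allowed (map (node c (leaf (minLabel A))) (internalTruncations B)) ≡ rightForkOk c A B
    rightTruncations c A (leaf _) = refl
    rightTruncations c A (node e B₁ B₂) with internalTruncations-node e B₁ B₂
    ... | rest , eq , ≥3 rewrite eq
        | all-allowed-≥4 (map (node c (leaf (minLabel A))) rest) (All.map⁺ (All.map s≤s ≥3))
        = ∧-identityʳ _

    leftTruncations : ∀ c A B → all allowed (joins c (internalTruncations A) (truncations′ B)) ≡ leftForkOk c A B
    leftTruncations c (leaf _) B = refl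
    leftTruncations c (node d A₁ A₂) B with internalTruncations-node d A₁ A₂
    ... | rest , eq , ≥3 rewrite eq
        | all-++ allowed (map (node c (cherry d A₁ A₂)) (truncations′ B)) (joins c rest (truncations′ B))
        | all-allowed-≥4 (map (node c (cherry d A₁ A₂)) (internalTruncations B))
             (All.map⁺ (All.map (+-mono-≤ {2} ≤-refl) (internalTruncations-size≥2 B)))
        | all-allowed-≥4 (joins c rest (truncations′ B))
             (All-joins c rest (truncations′ B) ≥3 (s≤s z≤n ∷ All.map (≤-trans (s≤s z≤n)) (internalTruncations-size≥2 B))
                        +-mono-≤)
        = trans (∧-identityʳ _) (∧-identityʳ _)

  internalTruncations-allowed : ∀ c A B →
    all allowed (internalTruncations (node c A B)) ≡ leftForkOk c A B ∧ rightForkOk c A B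
  internalTruncations-allowed c A B =
    begin
      all allowed (joins c (truncations A) (truncations B))
    ≡⟨ cong₂ (λ xs ys → all allowed (joins c xs ys)) (truncations≡ A) (truncations≡ B) ⟩
      all allowed (map (node c (leaf (minLabel A))) (truncations′ B) ++ joins c (internalTruncations A) (truncations′ B))
    ≡⟨ all-++ allowed (map (node c (leaf (minLabel A))) (truncations′ B)) _ ⟩
      (allowed (node c (leaf (minLabel A)) (leaf (minLabel B)))
         ∧ all allowed (map (node c (leaf (minLabel A))) (internalTruncations B)))
        ∧ all allowed (joins c (internalTruncations A) (truncations′ B))
    ≡⟨ cong₂ (λ x y → (x ∧ y) ∧ all allowed (joins c (internalTruncations A) (truncations′ B)))
             (allowed-≢3 (node c (leaf (minLabel A)) (leaf (minLabel B))) (λ ())) (rightTruncations c A B) ⟩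
      rightForkOk c A B ∧ all allowed (joins c (internalTruncations A) (truncations′ B))
    ≡⟨ cong (rightForkOk c A B ∧_) (leftTruncations c A B) ⟩
      rightForkOk c A B ∧ leftForkOk c A B
    ≡⟨ ∧-comm (rightForkOk c A B) _ ⟩
      leftForkOk c A B ∧ rightForkOk c A B
    ∎
    where open ≡-Reasoning

  avoids≡forksOk : ∀ t → avoids P t ≡ forksOk t
  avoids≡forksOk (leaf _) = refl
  avoids≡forksOk (node c A B) =
    begin
      all allowed (internalTruncations (node c A B) ++ (subtrees A ++ subtrees B))
    ≡⟨ all-++ allowed (internalTruncations (node c A B)) _ ⟩
      all allowed (internalTruncations (node c A B)) ∧ all allowed (subtrees A ++ subtrees B)
    ≡⟨ cong₂ _∧_ (internalTruncations-allowed c A B)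
                 (trans (all-++ allowed (subtrees A) (subtrees B)) (cong₂ _∧_ (avoids≡forksOk A) (avoids≡forksOk B))) ⟩
      (leftForkOk c A B ∧ rightForkOk c A B) ∧ (forksOk A ∧ forksOk B)
    ≡⟨ ∧-assoc (leftForkOk c A B) _ _ ⟩
      forksOk (node c A B)
    ∎
    where open ≡-Reasoning

-- Forks and the six pattern sets

data Shape : Set where
  left₁₂ left₁₃ right₂₃ : Shape

fork : Shape → Col → Col → Tree
fork left₁₂ c d = node c (node d l1 l2) l3
fork left₁₃ c d = node c (node d l1 l3) l2
fork right₂₃ c d = node c l1 (node d l2 l3)

leftShape : ℕ → ℕ → Shape
leftShape a₂ b = if a₂ <ᵇ b then left₁₂ else left₁₃

rank-∷-≤ : ∀ x {y} ys → y ≤ x → rank x (y ∷ ys) ≡ suc (rank x ys)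
rank-∷-≤ x ys y≤x = cong length (filter-accept (_≤? x) y≤x)

rank-∷-> : ∀ x {y} ys → x < y → rank x (y ∷ ys) ≡ rank x ys
rank-∷-> x ys x<y = cong length (filter-reject (_≤? x) (<⇒≱ x<y))

rank-≤>> : ∀ x {a b c} → a ≤ x → x < b → x < c → rank x (a ∷ b ∷ c ∷ []) ≡ 1
rank-≤>> x a≤x x<b x<c = trans (rank-∷-≤ x _ a≤x) (cong suc (trans (rank-∷-> x _ x<b) (rank-∷-> x [] x<c)))

rank-≤≤> : ∀ x {a b c} → a ≤ x → b ≤ x → x < c → rank x (a ∷ b ∷ c ∷ []) ≡ 2
rank-≤≤> x a≤x b≤x x<c =
  trans (rank-∷-≤ x _ a≤x) (cong suc (trans (rank-∷-≤ x _ b≤x) (cong suc (rank-∷-> x [] x<c))))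

rank-≤>≤ : ∀ x {a b c} → a ≤ x → x < b → c ≤ x → rank x (a ∷ b ∷ c ∷ []) ≡ 2
rank-≤>≤ x a≤x x<b c≤x = trans (rank-∷-≤ x _ a≤x) (cong suc (trans (rank-∷-> x _ x<b) (rank-∷-≤ x [] c≤x)))

rank-≤≤≤ : ∀ x {a b c} → a ≤ x → b ≤ x → c ≤ x → rank x (a ∷ b ∷ c ∷ []) ≡ 3
rank-≤≤≤ x a≤x b≤x c≤x =
  trans (rank-∷-≤ x _ a≤x) (cong suc (trans (rank-∷-≤ x _ b≤x) (cong suc (rank-∷-≤ x [] c≤x))))

st-leftFork : ∀ c d {a₁ a₂ b} → a₁ < a₂ → a₁ < b → a₂ ≢ b →
              st (node c (node d (leaf a₁) (leaf a₂)) (leaf b)) ≡ fork (leftShape a₂ b) c d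
st-leftFork c d {a₁} {a₂} {b} a₁<a₂ a₁<b a₂≢b with <-cmp a₂ b
... | tri< a₂<b _ _ rewrite <ᵇ-true a₂<b =
  relabelled (rank-≤>> a₁ ≤-refl a₁<a₂ a₁<b)
             (rank-≤≤> a₂ (<⇒≤ a₁<a₂) ≤-refl a₂<b)
             (rank-≤≤≤ b (<⇒≤ a₁<b) (<⇒≤ a₂<b) ≤-refl)
  where
  relabelled : ∀ {r₁ r₂ r₃} → r₁ ≡ 1 → r₂ ≡ 2 → r₃ ≡ 3 →
               node c (node d (leaf r₁) (leaf r₂)) (leaf r₃) ≡ fork left₁₂ c d
  relabelled refl refl refl = refl
... | tri≈ _ a₂≡b _ = ⊥-elim (a₂≢b a₂≡b)
... | tri> _ _ b<a₂ rewrite <ᵇ-false (<⇒≤ b<a₂) =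
  relabelled (rank-≤>> a₁ ≤-refl a₁<a₂ a₁<b)
             (rank-≤≤≤ a₂ (<⇒≤ a₁<a₂) ≤-refl (<⇒≤ b<a₂))
             (rank-≤>≤ b (<⇒≤ a₁<b) b<a₂ ≤-refl)
  where
  relabelled : ∀ {r₁ r₂ r₃} → r₁ ≡ 1 → r₂ ≡ 3 → r₃ ≡ 2 →
               node c (node d (leaf r₁) (leaf r₂)) (leaf r₃) ≡ fork left₁₃ c d
  relabelled refl refl refl = refl

st-rightFork : ∀ c e {a b₁ b₂} → a < b₁ → b₁ < b₂ →
               st (node c (leaf a) (node e (leaf b₁) (leaf b₂))) ≡ fork right₂₃ c e
st-rightFork c e {a} {b₁} {b₂} a<b₁ b₁<b₂ =
  relabelled (rank-≤>> a ≤-refl a<b₁ (<-trans a<b₁ b₁<b₂))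
             (rank-≤≤> b₁ (<⇒≤ a<b₁) ≤-refl b₁<b₂)
             (rank-≤≤≤ b₂ (<⇒≤ (<-trans a<b₁ b₁<b₂)) (<⇒≤ b₁<b₂) ≤-refl)
  where
  relabelled : ∀ {r₁ r₂ r₃} → r₁ ≡ 1 → r₂ ≡ 2 → r₃ ≡ 3 →
               node c (leaf r₁) (node e (leaf r₂) (leaf r₃)) ≡ fork right₂₃ c e
  relabelled refl refl refl = refl

leftFork-distinct : ∀ {d A₁ A₂ B} → Disjoint (leaves (node d A₁ A₂)) (leaves B) → minLabel A₂ ≢ minLabel B
leftFork-distinct {A₁ = A₁} {A₂} {B} disjoint eq =
  disjoint (∈-++⁺ʳ (leaves A₁) (minLabel-∈ A₂) , subst (_∈ leaves B) (sym eq) (minLabel-∈ B))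

admits : Shape → Shape → Bool
admits left₁₂ left₁₂ = false
admits left₁₃ left₁₃ = false
admits right₂₃ right₂₃ = false
admits _ _ = true


colourOf : Fin 6 → Col
colourOf 0F = ∘
colourOf 1F = ∘
colourOf 2F = ∘
colourOf _ = •

excludedOf : Fin 6 → Shape
excludedOf 0F = right₂₃
excludedOf 1F = left₁₂
excludedOf 2F = left₁₃
excludedOf 3F = right₂₃
excludedOf 4F = left₁₂
excludedOf 5F = left₁₃

allowedFork : Col → Shape → Shape → Col → Col → Bool
allowedFork κ σ s c d = (c ==ᶜ κ) ∧ ((d ==ᶜ κ) ∧ admits σ s)

∀-Col² : {P : Col → Col → Set} → P ∘ ∘ → P ∘ • → P • ∘ → P • • → ∀ c d → P c d
∀-Col² p∘∘ _ _ _ ∘ ∘ = p∘∘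
∀-Col² _ p∘• _ _ ∘ • = p∘•
∀-Col² _ _ p•∘ _ • ∘ = p•∘
∀-Col² _ _ _ p•• • • = p••

sixSets-fork : ∀ i s c d → not (sixSets i (fork s c d)) ≡ allowedFork (colourOf i) (excludedOf i) s c d
sixSets-fork 0F left₁₂ = ∀-Col² refl refl refl refl
sixSets-fork 0F left₁₃ = ∀-Col² refl refl refl refl
sixSets-fork 0F right₂₃ = ∀-Col² refl refl refl refl
sixSets-fork 1F left₁₂ = ∀-Col² refl refl refl refl
sixSets-fork 1F left₁₃ = ∀-Col² refl refl refl refl
sixSets-fork 1F right₂₃ = ∀-Col² refl refl refl refl
sixSets-fork 2F left₁₂ = ∀-Col² refl refl refl refl
sixSets-fork 2F left₁₃ = ∀-Col² refl refl refl refl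
sixSets-fork 2F right₂₃ = ∀-Col² refl refl refl refl
sixSets-fork 3F left₁₂ = ∀-Col² refl refl refl refl
sixSets-fork 3F left₁₃ = ∀-Col² refl refl refl refl
sixSets-fork 3F right₂₃ = ∀-Col² refl refl refl refl
sixSets-fork 4F left₁₂ = ∀-Col² refl refl refl refl
sixSets-fork 4F left₁₃ = ∀-Col² refl refl refl refl
sixSets-fork 4F right₂₃ = ∀-Col² refl refl refl refl
sixSets-fork 5F left₁₂ = ∀-Col² refl refl refl refl
sixSets-fork 5F left₁₃ = ∀-Col² refl refl refl refl
sixSets-fork 5F right₂₃ = ∀-Col² refl refl refl refl

labelsAre3-≢3 : ∀ X → size X ≢ 3 → labelsAre 3 X ≡ false
labelsAre3-≢3 X ≢3 with length (leaves X) ≡ᵇ 3 in eq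
... | false = refl
... | true = ⊥-elim (≢3 (trans (sym (length-leaves X)) (≡ᵇ⇒≡ _ 3 (subst T (sym eq) tt))))

sixSets-threeLeaved : ∀ i X → size X ≢ 3 → sixSets i X ≡ false
sixSets-threeLeaved 0F X ≢3 rewrite labelsAre3-≢3 X ≢3 = refl
sixSets-threeLeaved 1F X ≢3 rewrite labelsAre3-≢3 X ≢3 = refl
sixSets-threeLeaved 2F X ≢3 rewrite labelsAre3-≢3 X ≢3 = refl
sixSets-threeLeaved 3F X ≢3 rewrite labelsAre3-≢3 X ≢3 = refl
sixSets-threeLeaved 4F X ≢3 rewrite labelsAre3-≢3 X ≢3 = refl
sixSets-threeLeaved 5F X ≢3 rewrite labelsAre3-≢3 X ≢3 = refl

leftAllowed : Col → Shape → Col → Tree → Tree → Bool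
leftAllowed κ σ c (leaf _) B = true
leftAllowed κ σ c (node d _ A₂) B = allowedFork κ σ (leftShape (minLabel A₂) (minLabel B)) c d

rightAllowed : Col → Shape → Col → Tree → Bool
rightAllowed κ σ c (leaf _) = true
rightAllowed κ σ c (node e _ _) = allowedFork κ σ right₂₃ c e

forksAllowed : Col → Shape → Tree → Bool
forksAllowed κ σ (leaf _) = true
forksAllowed κ σ (node c A B) =
  leftAllowed κ σ c A B ∧ (rightAllowed κ σ c B ∧ (forksAllowed κ σ A ∧ forksAllowed κ σ B))

module _ (i : Fin 6) where
  open ThreeLeafPatterns (sixSets i) (sixSets-threeLeaved i)

  forksOk≡forksAllowed : ∀ t → T (minCond t) → Unique (leaves t) →
                         forksOk t ≡ forksAllowed (colourOf i) (excludedOf i) t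
  forksOk≡forksAllowed (leaf _) _ _ = refl
  forksOk≡forksAllowed (node c A B) mc u with minCond-node {c} {A} {B} mc | Unique-++⁻ (leaves A) (leaves B) u
  ... | A<B , mcA , mcB | uA , uB , disjoint =
    cong₂ _∧_ (leftFork≡ A A<B mcA disjoint)
              (cong₂ _∧_ (rightFork≡ B A<B mcB)
                         (cong₂ _∧_ (forksOk≡forksAllowed A mcA uA) (forksOk≡forksAllowed B mcB uB)))
    where
    leftFork≡ : ∀ A → minLabel A < minLabel B → T (minCond A) → Disjoint (leaves A) (leaves B) →
                leftForkOk c A B ≡ leftAllowed (colourOf i) (excludedOf i) c A B
    leftFork≡ (leaf _) _ _ _ = refl
    leftFork≡ (node d A₁ A₂) A<B mcA disjoint =
      let A₁<A₂ , _ = minCond-node {d} {A₁} {A₂} mcA in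
      trans (cong (λ X → not (sixSets i X))
                  (st-leftFork c d A₁<A₂ (subst (_< minLabel B) (minLabel-node d A₁ A₂ A₁<A₂) A<B)
                               (leftFork-distinct {d} {A₁} {A₂} {B} disjoint)))
            (sixSets-fork i _ c d)
    rightFork≡ : ∀ B → minLabel A < minLabel B → T (minCond B) →
                 rightForkOk c A B ≡ rightAllowed (colourOf i) (excludedOf i) c B
    rightFork≡ (leaf _) _ _ = refl
    rightFork≡ (node e B₁ B₂) A<B mcB =
      let B₁<B₂ , _ = minCond-node {e} {B₁} {B₂} mcB in
      trans (cong (λ X → not (sixSets i X))
                  (st-rightFork c e (subst (minLabel A <_) (minLabel-node e B₁ B₂ B₁<B₂) A<B) B₁<B₂))
            (sixSets-fork i right₂₃ c e)

-- Neither fork at a vertex c(A,B) has shape σ; the left fork c(d(A₁,A₂),B) has shape left₁₂ iff min A₂ < min B.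
lacksFork : Shape → Tree → Tree → Bool
lacksFork right₂₃ A (leaf _) = true
lacksFork right₂₃ A (node _ _ _) = false
lacksFork left₁₂ (leaf _) B = true
lacksFork left₁₂ (node _ _ A₂) B = not (minLabel A₂ <ᵇ minLabel B)
lacksFork left₁₃ (leaf _) B = true
lacksFork left₁₃ (node _ _ A₂) B = minLabel A₂ <ᵇ minLabel B

Shaped : Col → Shape → Tree → Bool
Shaped κ σ (leaf _) = true
Shaped κ σ (node c A B) = (c ==ᶜ κ) ∧ (lacksFork σ A B ∧ (Shaped κ σ A ∧ Shaped κ σ B))

==ᶜ⇒≡ : ∀ {c κ} → T (c ==ᶜ κ) → c ≡ κ
==ᶜ⇒≡ {∘} {∘} _ = refl
==ᶜ⇒≡ {•} {•} _ = refl

==ᶜ-refl : ∀ κ → T (κ ==ᶜ κ)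
==ᶜ-refl ∘ = tt
==ᶜ-refl • = tt

RootColoured : Col → Tree → Set
RootColoured κ (leaf _) = ⊤
RootColoured κ (node c _ _) = c ≡ κ

allowedFork⁻ : ∀ κ σ s c d → T (allowedFork κ σ s c d) → c ≡ κ × d ≡ κ × T (admits σ s)
allowedFork⁻ κ σ s c d allowed =
  let c≡κ , rest = T-∧⁻ {c ==ᶜ κ} allowed ; d≡κ , admitted = T-∧⁻ {d ==ᶜ κ} rest in
  ==ᶜ⇒≡ c≡κ , ==ᶜ⇒≡ d≡κ , admitted

allowedFork⁺ : ∀ {κ σ s c d} → c ≡ κ → d ≡ κ → T (admits σ s) → T (allowedFork κ σ s c d)
allowedFork⁺ {κ} refl refl admitted = T-∧⁺ (==ᶜ-refl κ) (T-∧⁺ (==ᶜ-refl κ) admitted)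

Shaped-node⁻ : ∀ κ σ c A B → T (Shaped κ σ (node c A B)) →
               c ≡ κ × T (lacksFork σ A B) × T (Shaped κ σ A) × T (Shaped κ σ B)
Shaped-node⁻ κ σ c A B shaped =
  let c≡κ , rest = T-∧⁻ {c ==ᶜ κ} shaped ; lacks , children = T-∧⁻ {lacksFork σ A B} rest
      shapedA , shapedB = T-∧⁻ {Shaped κ σ A} children in
  ==ᶜ⇒≡ c≡κ , lacks , shapedA , shapedB

Shaped-node⁺ : ∀ κ σ {A B} → T (lacksFork σ A B) → T (Shaped κ σ A) → T (Shaped κ σ B) →
               T (Shaped κ σ (node κ A B))
Shaped-node⁺ κ σ lacks shapedA shapedB = T-∧⁺ (==ᶜ-refl κ) (T-∧⁺ lacks (T-∧⁺ shapedA shapedB))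

forksAllowed-node⁻ : ∀ {κ σ} c A B → T (forksAllowed κ σ (node c A B)) →
                     T (leftAllowed κ σ c A B) × T (rightAllowed κ σ c B) ×
                     T (forksAllowed κ σ A) × T (forksAllowed κ σ B)
forksAllowed-node⁻ {κ} {σ} c A B allowed =
  let leftOk , rest = T-∧⁻ {leftAllowed κ σ c A B} allowed ; rightOk , children = T-∧⁻ {rightAllowed κ σ c B} rest
      allowedA , allowedB = T-∧⁻ {forksAllowed κ σ A} children in
  leftOk , rightOk , allowedA , allowedB

Shaped-RootColoured : ∀ κ σ t → T (Shaped κ σ t) → RootColoured κ t
Shaped-RootColoured κ σ (leaf _) _ = tt
Shaped-RootColoured κ σ (node c A B) shaped = proj₁ (Shaped-node⁻ κ σ c A B shaped)

lacksFork⇒admits-left : ∀ σ {d A₁ A₂} B → T (lacksFork σ (node d A₁ A₂) B) →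
                        T (admits σ (leftShape (minLabel A₂) (minLabel B)))
lacksFork⇒admits-left left₁₂ {A₂ = A₂} B lacks with minLabel A₂ <ᵇ minLabel B
... | false = tt
lacksFork⇒admits-left left₁₃ {A₂ = A₂} B lacks with minLabel A₂ <ᵇ minLabel B
... | true = tt
lacksFork⇒admits-left right₂₃ {A₂ = A₂} B _ with minLabel A₂ <ᵇ minLabel B
... | true = tt
... | false = tt

lacksFork⇒admits-right : ∀ σ A {e B₁ B₂} → T (lacksFork σ A (node e B₁ B₂)) → T (admits σ right₂₃)
lacksFork⇒admits-right left₁₂ _ _ = tt
lacksFork⇒admits-right left₁₃ _ _ = tt

allowed⇒lacksFork : ∀ κ σ A B → T (leftAllowed κ σ κ A B) → T (rightAllowed κ σ κ B) → T (lacksFork σ A B)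
allowed⇒lacksFork κ right₂₃ A (leaf _) _ _ = tt
allowed⇒lacksFork κ right₂₃ A (node e _ _) _ rightOk = proj₂ (proj₂ (allowedFork⁻ κ right₂₃ right₂₃ κ e rightOk))
allowed⇒lacksFork κ left₁₂ (leaf _) B _ _ = tt
allowed⇒lacksFork κ left₁₂ (node d _ A₂) B leftOk _
  with minLabel A₂ <ᵇ minLabel B
     | proj₂ (proj₂ (allowedFork⁻ κ left₁₂ (leftShape (minLabel A₂) (minLabel B)) κ d leftOk))
... | false | _ = tt
allowed⇒lacksFork κ left₁₃ (leaf _) B _ _ = tt
allowed⇒lacksFork κ left₁₃ (node d _ A₂) B leftOk _
  with minLabel A₂ <ᵇ minLabel B
     | proj₂ (proj₂ (allowedFork⁻ κ left₁₃ (leftShape (minLabel A₂) (minLabel B)) κ d leftOk))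
... | true | _ = tt

leftAllowed-RootColoured : ∀ κ σ c A B → T (leftAllowed κ σ c A B) → RootColoured κ A
leftAllowed-RootColoured κ σ c (leaf _) B _ = tt
leftAllowed-RootColoured κ σ c (node d _ A₂) B leftOk =
  proj₁ (proj₂ (allowedFork⁻ κ σ (leftShape (minLabel A₂) (minLabel B)) c d leftOk))

rightAllowed-RootColoured : ∀ κ σ c B → T (rightAllowed κ σ c B) → RootColoured κ B
rightAllowed-RootColoured κ σ c (leaf _) _ = tt
rightAllowed-RootColoured κ σ c (node e _ _) rightOk = proj₁ (proj₂ (allowedFork⁻ κ σ right₂₃ c e rightOk))

Shaped⇒forksAllowed : ∀ κ σ t → T (Shaped κ σ t) → T (forksAllowed κ σ t)
Shaped⇒forksAllowed κ σ (leaf _) _ = tt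
Shaped⇒forksAllowed κ σ (node c A B) shaped =
  let c≡κ , lacks , shapedA , shapedB = Shaped-node⁻ κ σ c A B shaped in
  T-∧⁺ (leftOk A lacks shapedA c≡κ)
       (T-∧⁺ (rightOk B lacks shapedB c≡κ)
             (T-∧⁺ (Shaped⇒forksAllowed κ σ A shapedA) (Shaped⇒forksAllowed κ σ B shapedB)))
  where
  leftOk : ∀ A → T (lacksFork σ A B) → T (Shaped κ σ A) → c ≡ κ → T (leftAllowed κ σ c A B)
  leftOk (leaf _) _ _ _ = tt
  leftOk (node d A₁ A₂) lacks shapedA c≡κ =
    allowedFork⁺ c≡κ (Shaped-RootColoured κ σ (node d A₁ A₂) shapedA) (lacksFork⇒admits-left σ B lacks)
  rightOk : ∀ B → T (lacksFork σ A B) → T (Shaped κ σ B) → c ≡ κ → T (rightAllowed κ σ c B)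
  rightOk (leaf _) _ _ _ = tt
  rightOk (node e B₁ B₂) lacks shapedB c≡κ =
    allowedFork⁺ c≡κ (Shaped-RootColoured κ σ (node e B₁ B₂) shapedB) (lacksFork⇒admits-right σ A lacks)

forksAllowed⇒Shaped : ∀ κ σ t → RootColoured κ t → T (forksAllowed κ σ t) → T (Shaped κ σ t)
forksAllowed⇒Shaped κ σ (leaf _) _ _ = tt
forksAllowed⇒Shaped κ σ (node c A B) refl allowed =
  let leftOk , rightOk , allowedA , allowedB = forksAllowed-node⁻ c A B allowed in
  Shaped-node⁺ κ σ (allowed⇒lacksFork κ σ A B leftOk rightOk)
               (forksAllowed⇒Shaped κ σ A (leftAllowed-RootColoured κ σ κ A B leftOk) allowedA)
               (forksAllowed⇒Shaped κ σ B (rightAllowed-RootColoured κ σ κ B rightOk) allowedB)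

-- With three or more leaves the root lies on a fork, which fixes its colour.
forksAllowed-RootColoured : ∀ κ σ t → 3 ≤ size t → T (forksAllowed κ σ t) → RootColoured κ t
forksAllowed-RootColoured κ σ (node c (node d A₁ A₂) B) _ allowed =
  proj₁ (allowedFork⁻ κ σ _ c d (proj₁ (forksAllowed-node⁻ c (node d A₁ A₂) B allowed)))
forksAllowed-RootColoured κ σ (node c (leaf a) (node e B₁ B₂)) _ allowed =
  proj₁ (allowedFork⁻ κ σ right₂₃ c e (proj₁ (proj₂ (forksAllowed-node⁻ c (leaf a) (node e B₁ B₂) allowed))))
forksAllowed-RootColoured κ σ (node c (leaf _) (leaf _)) (s≤s (s≤s ())) _
forksAllowed-RootColoured κ σ (leaf _) (s≤s ()) _

avoids⇔Shaped : ∀ i t → T (minCond t) → Unique (leaves t) → 3 ≤ size t →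
                T (avoids (sixSets i) t) ⇔ T (Shaped (colourOf i) (excludedOf i) t)
avoids⇔Shaped i t mc u 3≤size = mk⇔
  (λ av → let allowed = subst T avoids≡forksAllowed av in
          forksAllowed⇒Shaped κ σ t (forksAllowed-RootColoured κ σ t 3≤size allowed) allowed)
  (λ shaped → subst T (sym avoids≡forksAllowed) (Shaped⇒forksAllowed κ σ t shaped))
  where
  κ : Col
  κ = colourOf i
  σ : Shape
  σ = excludedOf i
  open ThreeLeafPatterns (sixSets i) (sixSets-threeLeaved i)
  avoids≡forksAllowed : avoids (sixSets i) t ≡ forksAllowed κ σ t
  avoids≡forksAllowed = trans (avoids≡forksOk t) (forksOk≡forksAllowed i t mc u)

-- Grafting the largest leaf

data Vertex : Tree → Set where
  root : ∀ {t} → Vertex t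
  left : ∀ {c A B} → Vertex A → Vertex (node c A B)
  right : ∀ {c A B} → Vertex B → Vertex (node c A B)

LeftSpine : Tree → Set
LeftSpine (leaf _) = ⊤
LeftSpine (node _ A _) = ⊤ ⊎ LeftSpine A

LeafOf : Tree → Set
LeafOf (leaf _) = ⊤
LeafOf (node _ A B) = LeafOf A ⊎ LeafOf B

NonLeft NonLeft⁺ : Tree → Set
NonLeft t = ⊤ ⊎ NonLeft⁺ t
NonLeft⁺ (leaf _) = ⊥
NonLeft⁺ (node _ A B) = NonLeft⁺ A ⊎ NonLeft B

-- The admissible vertices for grafting the largest leaf without creating a fork of shape σ.
Slot : Shape → Tree → Set
Slot right₂₃ = LeftSpine
Slot left₁₂ = LeafOf
Slot left₁₃ = NonLeft

spineVertex : ∀ t → LeftSpine t → Vertex t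
spineVertex (leaf _) _ = root
spineVertex (node _ A _) (inj₁ _) = root
spineVertex (node _ A _) (inj₂ p) = left (spineVertex A p)

leafVertex : ∀ t → LeafOf t → Vertex t
leafVertex (leaf _) _ = root
leafVertex (node _ A B) (inj₁ p) = left (leafVertex A p)
leafVertex (node _ A B) (inj₂ p) = right (leafVertex B p)

nonLeftVertex : ∀ t → NonLeft t → Vertex t
nonLeft⁺Vertex : ∀ t → NonLeft⁺ t → Vertex t
nonLeftVertex t (inj₁ _) = root
nonLeftVertex t (inj₂ p) = nonLeft⁺Vertex t p
nonLeft⁺Vertex (node _ A B) (inj₁ p) = left (nonLeft⁺Vertex A p)
nonLeft⁺Vertex (node _ A B) (inj₂ p) = right (nonLeftVertex B p)

slotVertex : ∀ σ t → Slot σ t → Vertex t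
slotVertex right₂₃ = spineVertex
slotVertex left₁₂ = leafVertex
slotVertex left₁₃ = nonLeftVertex

left-injective : ∀ {c A B} {v w : Vertex A} → left {c} {A} {B} v ≡ left w → v ≡ w
left-injective refl = refl

right-injective : ∀ {c A B} {v w : Vertex B} → right {c} {A} {B} v ≡ right w → v ≡ w
right-injective refl = refl

spineVertex-injective : ∀ t p q → spineVertex t p ≡ spineVertex t q → p ≡ q
spineVertex-injective (leaf _) tt tt _ = refl
spineVertex-injective (node _ A _) (inj₁ tt) (inj₁ tt) _ = refl
spineVertex-injective (node _ A _) (inj₂ p) (inj₂ q) eq = cong inj₂ (spineVertex-injective A p q (left-injective eq))

leafVertex-injective : ∀ t p q → leafVertex t p ≡ leafVertex t q → p ≡ q
leafVertex-injective (leaf _) tt tt _ = refl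
leafVertex-injective (node _ A B) (inj₁ p) (inj₁ q) eq = cong inj₁ (leafVertex-injective A p q (left-injective eq))
leafVertex-injective (node _ A B) (inj₂ p) (inj₂ q) eq = cong inj₂ (leafVertex-injective B p q (right-injective eq))

nonLeft⁺Vertex≢root : ∀ t p → nonLeft⁺Vertex t p ≢ root
nonLeft⁺Vertex≢root (node _ A B) (inj₁ _) ()
nonLeft⁺Vertex≢root (node _ A B) (inj₂ _) ()

nonLeftVertex-injective : ∀ t p q → nonLeftVertex t p ≡ nonLeftVertex t q → p ≡ q
nonLeft⁺Vertex-injective : ∀ t p q → nonLeft⁺Vertex t p ≡ nonLeft⁺Vertex t q → p ≡ q
nonLeftVertex-injective t (inj₁ tt) (inj₁ tt) _ = refl
nonLeftVertex-injective t (inj₁ tt) (inj₂ q) eq = ⊥-elim (nonLeft⁺Vertex≢root t q (sym eq))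
nonLeftVertex-injective t (inj₂ p) (inj₁ tt) eq = ⊥-elim (nonLeft⁺Vertex≢root t p eq)
nonLeftVertex-injective t (inj₂ p) (inj₂ q) eq = cong inj₂ (nonLeft⁺Vertex-injective t p q eq)
nonLeft⁺Vertex-injective (node _ A B) (inj₁ p) (inj₁ q) eq = cong inj₁ (nonLeft⁺Vertex-injective A p q (left-injective eq))
nonLeft⁺Vertex-injective (node _ A B) (inj₂ p) (inj₂ q) eq = cong inj₂ (nonLeftVertex-injective B p q (right-injective eq))

slotVertex-injective : ∀ σ t p q → slotVertex σ t p ≡ slotVertex σ t q → p ≡ q
slotVertex-injective right₂₃ = spineVertex-injective
slotVertex-injective left₁₂ = leafVertex-injective
slotVertex-injective left₁₃ = nonLeftVertex-injective

LeafOf-count : ∀ t → LeafOf t ↔ Fin (size t)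
LeafOf-count (leaf _) = ↔-sym 1↔⊤
LeafOf-count (node _ A B) = ↔-trans (LeafOf-count A ⊎-↔ LeafOf-count B) (↔-sym +↔⊎)

internalCount : Tree → ℕ
internalCount (leaf _) = 0
internalCount (node _ A B) = internalCount A + size B

suc-internalCount : ∀ t → suc (internalCount t) ≡ size t
suc-internalCount (leaf _) = refl
suc-internalCount (node _ A B) = cong (_+ size B) (suc-internalCount A)

NonLeft-count : ∀ t → NonLeft t ↔ Fin (size t)
NonLeft⁺-count : ∀ t → NonLeft⁺ t ↔ Fin (internalCount t)
NonLeft-count t =
  subst (λ k → NonLeft t ↔ Fin k) (suc-internalCount t)
        (↔-trans (↔-sym 1↔⊤ ⊎-↔ NonLeft⁺-count t) (↔-sym (+↔⊎ {1} {internalCount t})))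
NonLeft⁺-count (leaf _) = ↔-sym 0↔⊥
NonLeft⁺-count (node _ A B) = ↔-trans (NonLeft⁺-count A ⊎-↔ NonLeft-count B) (↔-sym +↔⊎)

LeftSpine-count : ∀ κ t → T (Shaped κ right₂₃ t) → LeftSpine t ↔ Fin (size t)
LeftSpine-count κ (leaf _) _ = ↔-sym 1↔⊤
LeftSpine-count κ (node c A (leaf b)) shaped =
  let _ , _ , shapedA , _ = Shaped-node⁻ κ right₂₃ c A (leaf b) shaped in
  subst (λ k → LeftSpine (node c A (leaf b)) ↔ Fin k) (+-comm 1 (size A))
        (↔-trans (↔-sym 1↔⊤ ⊎-↔ LeftSpine-count κ A shapedA) (↔-sym (+↔⊎ {1} {size A})))
LeftSpine-count κ (node c A (node e B₁ B₂)) shaped = ⊥-elim (proj₁ (proj₂ (Shaped-node⁻ κ right₂₃ c A (node e B₁ B₂) shaped)))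

Slot-count : ∀ κ σ t → T (Shaped κ σ t) → Slot σ t ↔ Fin (size t)
Slot-count κ right₂₃ t = LeftSpine-count κ t
Slot-count κ left₁₂ t _ = LeafOf-count t
Slot-count κ left₁₃ t _ = NonLeft-count t

module Grafting (κ : Col) (m : ℕ) where

  graft : (t : Tree) → Vertex t → Tree
  graft t root = node κ t (leaf m)
  graft (node c A B) (left v) = node c (graft A v) B
  graft (node c A B) (right v) = node c A (graft B v)

  Below : Tree → Set
  Below t = All (_< m) (leaves t)

  Below-left : ∀ A B → All (_< m) (leaves A ++ leaves B) → Below A
  Below-left A B = All.++⁻ˡ (leaves A)

  Below-right : ∀ A B → All (_< m) (leaves A ++ leaves B) → Below B
  Below-right A B = All.++⁻ʳ (leaves A)

  minLabel-Below : ∀ t → Below t → minLabel t < m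
  minLabel-Below t below = All.lookup below (minLabel-∈ t)

  graft≢leaf : ∀ t v {x} → graft t v ≢ leaf x
  graft≢leaf t root ()
  graft≢leaf (node _ _ _) (left _) ()
  graft≢leaf (node _ _ _) (right _) ()

  size-graft : ∀ t v → size (graft t v) ≡ suc (size t)
  size-graft t root = +-comm (size t) 1
  size-graft (node c A B) (left v) = cong (_+ size B) (size-graft A v)
  size-graft (node c A B) (right v) = trans (cong (size A +_) (size-graft B v)) (+-suc (size A) (size B))

  m∈graft : ∀ t v → m ∈ leaves (graft t v)
  m∈graft t root = ∈-++⁺ʳ (leaves t) (here refl)
  m∈graft (node c A B) (left v) = ∈-++⁺ˡ (m∈graft A v)
  m∈graft (node c A B) (right v) = ∈-++⁺ʳ (leaves A) (m∈graft B v)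

  ∈-graft⁺ : ∀ {x} t v → x ∈ leaves t → x ∈ leaves (graft t v)
  ∈-graft⁺ t root x∈ = ∈-++⁺ˡ x∈
  ∈-graft⁺ (node c A B) (left v) x∈ with ∈-++⁻ (leaves A) x∈
  ... | inj₁ x∈A = ∈-++⁺ˡ (∈-graft⁺ A v x∈A)
  ... | inj₂ x∈B = ∈-++⁺ʳ (leaves (graft A v)) x∈B
  ∈-graft⁺ (node c A B) (right v) x∈ with ∈-++⁻ (leaves A) x∈
  ... | inj₁ x∈A = ∈-++⁺ˡ x∈A
  ... | inj₂ x∈B = ∈-++⁺ʳ (leaves A) (∈-graft⁺ B v x∈B)

  ∈-graft⁻ : ∀ {x} t v → x ∈ leaves (graft t v) → x ≡ m ⊎ x ∈ leaves t
  ∈-graft⁻ t root x∈ with ∈-++⁻ (leaves t) x∈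
  ... | inj₁ x∈t = inj₂ x∈t
  ... | inj₂ (here x≡m) = inj₁ x≡m
  ∈-graft⁻ (node c A B) (left v) x∈ with ∈-++⁻ (leaves (graft A v)) x∈
  ... | inj₂ x∈B = inj₂ (∈-++⁺ʳ (leaves A) x∈B)
  ... | inj₁ x∈A′ with ∈-graft⁻ A v x∈A′
  ...   | inj₁ x≡m = inj₁ x≡m
  ...   | inj₂ x∈A = inj₂ (∈-++⁺ˡ x∈A)
  ∈-graft⁻ (node c A B) (right v) x∈ with ∈-++⁻ (leaves A) x∈
  ... | inj₁ x∈A = inj₂ (∈-++⁺ˡ x∈A)
  ... | inj₂ x∈B′ with ∈-graft⁻ B v x∈B′
  ...   | inj₁ x≡m = inj₁ x≡m
  ...   | inj₂ x∈B = inj₂ (∈-++⁺ʳ (leaves A) x∈B)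

  minLabel-graft : ∀ t v → Below t → minLabel (graft t v) ≡ minLabel t
  minLabel-graft t root below = m≤n⇒m⊓n≡m (<⇒≤ (minLabel-Below t below))
  minLabel-graft (node c A B) (left v) below = cong (_⊓ minLabel B) (minLabel-graft A v (Below-left A B below))
  minLabel-graft (node c A B) (right v) below = cong (minLabel A ⊓_) (minLabel-graft B v (Below-right A B below))

  minCond-graft : ∀ t v → Below t → minCond (graft t v) ≡ minCond t
  minCond-graft t root below rewrite <ᵇ-true (minLabel-Below t below) = ∧-identityʳ (minCond t)
  minCond-graft (node c A B) (left v) below
    rewrite minLabel-graft A v (Below-left A B below) | minCond-graft A v (Below-left A B below) = refl
  minCond-graft (node c A B) (right v) below
    rewrite minLabel-graft B v (Below-right A B below) | minCond-graft B v (Below-right A B below) = refl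

  m∉Below : ∀ t → Below t → m ∉ leaves t
  m∉Below t below m∈ = <-irrefl refl (All.lookup below m∈)

  graft-injective : ∀ {t t′} v v′ → Below t → Below t′ → graft t v ≡ graft t′ v′ →
                    _≡_ {A = Σ Tree Vertex} (t , v) (t′ , v′)
  graft-injective root root _ _ refl = refl
  graft-injective {t′ = node c A B} root (left v′) _ below′ refl = ⊥-elim (m∉Below B (Below-right A B below′) (here refl))
  graft-injective {t = node c A B} (left v) root below _ refl = ⊥-elim (m∉Below B (Below-right A B below) (here refl))
  graft-injective {t′ = node c A B} root (right v′) _ _ eq with node-injective eq
  ... | _ , _ , m≡graft = ⊥-elim (graft≢leaf B v′ (sym m≡graft))
  graft-injective {t = node c A B} (right v) root _ _ eq with node-injective eq
  ... | _ , _ , graft≡m = ⊥-elim (graft≢leaf B v graft≡m)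
  graft-injective {node c A B} {node c′ A′ B′} (left v) (left v′) below below′ eq with node-injective eq
  ... | refl , A≡A′ , refl with graft-injective v v′ (Below-left A B below) (Below-left A′ B′ below′) A≡A′
  ...   | refl = refl
  graft-injective {node c A B} {node c′ A′ B′} (right v) (right v′) below below′ eq with node-injective eq
  ... | refl , refl , B≡B′ with graft-injective v v′ (Below-right A B below) (Below-right A′ B′ below′) B≡B′
  ...   | refl = refl
  graft-injective {node c A B} {node c′ A′ B′} (left v) (right v′) below _ eq with node-injective eq
  ... | _ , _ , B≡B′ =
    ⊥-elim (m∉Below B (Below-right A B below) (subst (λ X → m ∈ leaves X) (sym B≡B′) (m∈graft B′ v′)))
  graft-injective {node c A B} {node c′ A′ B′} (right v) (left v′) below _ eq with node-injective eq
  ... | _ , A≡A′ , _ =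
    ⊥-elim (m∉Below A (Below-left A B below) (subst (λ X → m ∈ leaves X) (sym A≡A′) (m∈graft A′ v′)))

  κ==κ : (κ ==ᶜ κ) ≡ true
  κ==κ = Equivalence.to T-≡ (==ᶜ-refl κ)

  lacksFork-right₂₃ : ∀ X Y B → lacksFork right₂₃ X B ≡ lacksFork right₂₃ Y B
  lacksFork-right₂₃ X Y (leaf _) = refl
  lacksFork-right₂₃ X Y (node _ _ _) = refl

  Shaped-graft-spine : ∀ t p → Below t → Shaped κ right₂₃ (graft t (spineVertex t p)) ≡ Shaped κ right₂₃ t
  Shaped-graft-spine (leaf _) _ _ rewrite κ==κ = refl
  Shaped-graft-spine (node c A B) (inj₁ _) _ rewrite κ==κ = ∧-identityʳ _
  Shaped-graft-spine (node c A B) (inj₂ p) below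
    rewrite lacksFork-right₂₃ (graft A (spineVertex A p)) A B | Shaped-graft-spine A p (Below-left A B below) = refl

  lacksFork-left₁₂-graftˡ : ∀ A p B → Below A → minLabel B < m →
                            lacksFork left₁₂ (graft A (leafVertex A p)) B ≡ lacksFork left₁₂ A B
  lacksFork-left₁₂-graftˡ (leaf _) _ B _ B<m rewrite <ᵇ-false (<⇒≤ B<m) = refl
  lacksFork-left₁₂-graftˡ (node d A₁ A₂) (inj₁ _) B _ _ = refl
  lacksFork-left₁₂-graftˡ (node d A₁ A₂) (inj₂ q) B below _
    rewrite minLabel-graft A₂ (leafVertex A₂ q) (Below-right A₁ A₂ below) = refl

  lacksFork-left₁₂-graftʳ : ∀ A B v → Below B → lacksFork left₁₂ A (graft B v) ≡ lacksFork left₁₂ A B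
  lacksFork-left₁₂-graftʳ (leaf _) B v _ = refl
  lacksFork-left₁₂-graftʳ (node d A₁ A₂) B v below rewrite minLabel-graft B v below = refl

  Shaped-graft-leaf : ∀ t p → Below t → Shaped κ left₁₂ (graft t (leafVertex t p)) ≡ Shaped κ left₁₂ t
  Shaped-graft-leaf (leaf _) _ _ rewrite κ==κ = refl
  Shaped-graft-leaf (node c A B) (inj₁ p) below
    rewrite lacksFork-left₁₂-graftˡ A p B (Below-left A B below) (minLabel-Below B (Below-right A B below))
          | Shaped-graft-leaf A p (Below-left A B below) = refl
  Shaped-graft-leaf (node c A B) (inj₂ p) below
    rewrite lacksFork-left₁₂-graftʳ A B (leafVertex B p) (Below-right A B below)
          | Shaped-graft-leaf B p (Below-right A B below) = refl

  lacksFork-left₁₃-graftˡ : ∀ A p B → Below A →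
                            lacksFork left₁₃ (graft A (nonLeft⁺Vertex A p)) B ≡ lacksFork left₁₃ A B
  lacksFork-left₁₃-graftˡ (node d A₁ A₂) (inj₁ _) B _ = refl
  lacksFork-left₁₃-graftˡ (node d A₁ A₂) (inj₂ q) B below
    rewrite minLabel-graft A₂ (nonLeftVertex A₂ q) (Below-right A₁ A₂ below) = refl

  lacksFork-left₁₃-graftʳ : ∀ A B v → Below B → lacksFork left₁₃ A (graft B v) ≡ lacksFork left₁₃ A B
  lacksFork-left₁₃-graftʳ (leaf _) B v _ = refl
  lacksFork-left₁₃-graftʳ (node d A₁ A₂) B v below rewrite minLabel-graft B v below = refl

  lacksFork-left₁₃-root : ∀ A → Below A → lacksFork left₁₃ A (leaf m) ≡ true
  lacksFork-left₁₃-root (leaf _) _ = refl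
  lacksFork-left₁₃-root (node d A₁ A₂) below = <ᵇ-true (minLabel-Below A₂ (Below-right A₁ A₂ below))

  Shaped-graft-nonLeft : ∀ t p → Below t → Shaped κ left₁₃ (graft t (nonLeftVertex t p)) ≡ Shaped κ left₁₃ t
  Shaped-graft-nonLeft t (inj₁ _) below rewrite κ==κ | lacksFork-left₁₃-root t below = ∧-identityʳ _
  Shaped-graft-nonLeft (node c A B) (inj₂ (inj₁ q)) below
    rewrite lacksFork-left₁₃-graftˡ A q B (Below-left A B below)
          | Shaped-graft-nonLeft A (inj₂ q) (Below-left A B below) = refl
  Shaped-graft-nonLeft (node c A B) (inj₂ (inj₂ r)) below
    rewrite lacksFork-left₁₃-graftʳ A B (nonLeftVertex B r) (Below-right A B below)
          | Shaped-graft-nonLeft B r (Below-right A B below) = refl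

  Shaped-graft : ∀ σ t p → Below t → Shaped κ σ (graft t (slotVertex σ t p)) ≡ Shaped κ σ t
  Shaped-graft right₂₃ = Shaped-graft-spine
  Shaped-graft left₁₂ = Shaped-graft-leaf
  Shaped-graft left₁₃ = Shaped-graft-nonLeft

  lacksFork-right₂₃-graft : ∀ A B v → lacksFork right₂₃ A (graft B v) ≡ false
  lacksFork-right₂₃-graft A B root = refl
  lacksFork-right₂₃-graft A (node _ _ _) (left _) = refl
  lacksFork-right₂₃-graft A (node _ _ _) (right _) = refl

  spine-slot : ∀ t v → T (Shaped κ right₂₃ (graft t v)) → Σ (LeftSpine t) λ p → spineVertex t p ≡ v
  spine-slot (leaf _) root _ = tt , refl
  spine-slot (node c A B) root _ = inj₁ tt , refl
  spine-slot (node c A B) (left v) shaped =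
    let _ , _ , shapedA , _ = Shaped-node⁻ κ right₂₃ c (graft A v) B shaped
        p , p↦v = spine-slot A v shapedA
    in inj₂ p , cong left p↦v
  spine-slot (node c A B) (right v) shaped =
    let _ , lacks , _ = Shaped-node⁻ κ right₂₃ c A (graft B v) shaped in
    ⊥-elim (subst T (lacksFork-right₂₃-graft A B v) lacks)

  leaf-slot : ∀ t v → Below t → T (Shaped κ left₁₂ (graft t v)) → Σ (LeafOf t) λ p → leafVertex t p ≡ v
  leaf-slot (leaf _) root _ _ = tt , refl
  leaf-slot (node c A B) root below shaped =
    let _ , lacks , _ = Shaped-node⁻ κ left₁₂ κ (node c A B) (leaf m) shaped in
    ⊥-elim (subst (λ b → T (not b)) (<ᵇ-true (minLabel-Below B (Below-right A B below))) lacks)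
  leaf-slot (node c A B) (left v) below shaped =
    let _ , _ , shapedA , _ = Shaped-node⁻ κ left₁₂ c (graft A v) B shaped
        p , p↦v = leaf-slot A v (Below-left A B below) shapedA
    in inj₁ p , cong left p↦v
  leaf-slot (node c A B) (right v) below shaped =
    let _ , _ , _ , shapedB = Shaped-node⁻ κ left₁₂ c A (graft B v) shaped
        p , p↦v = leaf-slot B v (Below-right A B below) shapedB
    in inj₂ p , cong right p↦v

  nonLeft-slot : ∀ t v → Below t → T (Shaped κ left₁₃ (graft t v)) → Σ (NonLeft t) λ p → nonLeftVertex t p ≡ v
  nonLeft-slot-left : ∀ {c} A B v → v ≢ root → Below (node c A B) → T (Shaped κ left₁₃ (node c (graft A v) B)) →
                      Σ (NonLeft (node c A B)) λ p → nonLeftVertex (node c A B) p ≡ left v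
  nonLeft-slot t root _ _ = inj₁ tt , refl
  nonLeft-slot (node c A B) (left root) below shaped =
    let _ , lacks , _ = Shaped-node⁻ κ left₁₃ c (node κ A (leaf m)) B shaped in
    ⊥-elim (<-asym (<ᵇ⇒< m _ lacks) (minLabel-Below B (Below-right A B below)))
  nonLeft-slot (node c A B) (left v@(left _)) below shaped = nonLeft-slot-left A B v (λ ()) below shaped
  nonLeft-slot (node c A B) (left v@(right _)) below shaped = nonLeft-slot-left A B v (λ ()) below shaped
  nonLeft-slot (node c A B) (right v) below shaped =
    let _ , _ , _ , shapedB = Shaped-node⁻ κ left₁₃ c A (graft B v) shaped
        p , p↦v = nonLeft-slot B v (Below-right A B below) shapedB
    in inj₂ (inj₂ p) , cong right p↦v

  nonLeft-slot-left {c} A B v v≢root below shaped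
    with nonLeft-slot A v (Below-left A B below) (proj₁ (proj₂ (proj₂ (Shaped-node⁻ κ left₁₃ c (graft A v) B shaped))))
  ... | inj₁ _ , root≡v = ⊥-elim (v≢root (sym root≡v))
  ... | inj₂ p , p↦v = inj₂ (inj₁ p) , cong left p↦v

  graft-slot : ∀ σ t v → Below t → T (Shaped κ σ (graft t v)) → Σ (Slot σ t) λ p → slotVertex σ t p ≡ v
  graft-slot right₂₃ t v _ = spine-slot t v
  graft-slot left₁₂ = leaf-slot
  graft-slot left₁₃ = nonLeft-slot

  All-≤⇒Below : ∀ xs → All (_≤ m) xs → m ∉ xs → All (_< m) xs
  All-≤⇒Below [] [] _ = []
  All-≤⇒Below (x ∷ xs) (x≤m ∷ ps) m∉ =
    ≤∧≢⇒< x≤m (λ x≡m → m∉ (here (sym x≡m))) ∷ All-≤⇒Below xs ps (λ m∈ → m∉ (there m∈))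

  -- In a tree satisfying the minimum condition the largest label m is a right child, so removing it
  -- (and contracting its parent) undoes a graft.
  prune : ∀ {σ} c A B → T (Shaped κ σ (node c A B)) → T (minCond (node c A B)) → Unique (leaves (node c A B)) →
          All (_≤ m) (leaves (node c A B)) → m ∈ leaves (node c A B) →
          Σ Tree λ t → Σ (Vertex t) λ v → graft t v ≡ node c A B × Below t
  prune {σ} c A B shaped mc u ≤m m∈ with Shaped-node⁻ κ σ c A B shaped | minCond-node {c} {A} {B} mc
                                        | Unique-++⁻ (leaves A) (leaves B) u | ∈-++⁻ (leaves A) m∈
  prune c (leaf _) B shaped mc u ≤m m∈ | _ , _ , _ , _ | A<B , _ , _ | _ , _ , _ | inj₁ (here refl) =
    ⊥-elim (<-irrefl refl (<-≤-trans A<B (All.lookup (All.++⁻ʳ (m ∷ []) ≤m) (minLabel-∈ B))))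
  prune c A (leaf _) shaped mc u ≤m m∈ | c≡κ , _ , _ , _ | _ , _ , _ | _ , _ , disjoint | inj₂ (here refl) =
    A , root , cong (λ c → node c A (leaf m)) (sym c≡κ)
    , All-≤⇒Below (leaves A) (All.++⁻ˡ (leaves A) ≤m) (λ m∈A → disjoint (m∈A , here refl))
  prune {σ} c (node d A₁ A₂) B shaped mc u ≤m m∈ | _ , _ , shapedA , _ | _ , mcA , _ | uA , _ , disjoint | inj₁ m∈A =
    let A₀ , v₀ , eq₀ , below₀ = prune {σ} d A₁ A₂ shapedA mcA uA (All.++⁻ˡ (leaves (node d A₁ A₂)) ≤m) m∈A in
    node c A₀ B , left v₀ , cong (λ X → node c X B) eq₀
    , All.++⁺ below₀ (All-≤⇒Below (leaves B) (All.++⁻ʳ (leaves (node d A₁ A₂)) ≤m)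
                                  (λ m∈B → disjoint (m∈A , m∈B)))
  prune {σ} c A (node e B₁ B₂) shaped mc u ≤m m∈ | _ , _ , _ , shapedB | _ , _ , mcB | _ , uB , disjoint | inj₂ m∈B =
    let B₀ , v₀ , eq₀ , below₀ = prune {σ} e B₁ B₂ shapedB mcB uB (All.++⁻ʳ (leaves A) ≤m) m∈B in
    node c A B₀ , right v₀ , cong (node c A) eq₀
    , All.++⁺ (All-≤⇒Below (leaves A) (All.++⁻ˡ (leaves A) ≤m) (λ m∈A → disjoint (m∈A , m∈B))) below₀

  graft-slot-injective : ∀ σ {t t′} p p′ → Below t → Below t′ →
                         graft t (slotVertex σ t p) ≡ graft t′ (slotVertex σ t′ p′) →
                         _≡_ {A = Σ Tree (Slot σ)} (t , p) (t′ , p′)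
  graft-slot-injective σ {t} p p′ below below′ eq
    with Σ-≡,≡←≡ (graft-injective (slotVertex σ t p) _ below below′ eq)
  ... | refl , v≡v′ = cong (t ,_) (slotVertex-injective σ t p p′ v≡v′)

module Growth (κ : Col) (σ : Shape) (n : ℕ) where
  open Grafting κ (suc n)

  Labelled⇒Below : ∀ t → Labelled n t → Below t
  Labelled⇒Below t labelled = All.map s≤s (proj₂ (Labelled⇒Unique×bounded t labelled))

  Labelled-graft : ∀ t v → Labelled n t → Labelled (suc n) (graft t v)
  Labelled-graft t v (size≡n , cover) = trans (size-graft t v) (cong suc size≡n) , cover′
    where
    cover′ : ∀ i → i < suc n → suc i ∈ leaves (graft t v)
    cover′ i i<1+n with m<1+n⇒m<n∨m≡n i<1+n
    ... | inj₁ i<n = ∈-graft⁺ t v (cover i i<n)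
    ... | inj₂ refl = m∈graft t v

  Labelled-prune : ∀ t v → Labelled (suc n) (graft t v) → Labelled n t
  Labelled-prune t v (size≡1+n , cover) = suc-injective (trans (sym (size-graft t v)) size≡1+n) , cover′
    where
    cover′ : ∀ i → i < n → suc i ∈ leaves t
    cover′ i i<n with ∈-graft⁻ t v (cover i (m<n⇒m<1+n i<n))
    ... | inj₁ 1+i≡1+n = ⊥-elim (<-irrefl (suc-injective 1+i≡1+n) i<n)
    ... | inj₂ 1+i∈t = 1+i∈t

  Extension : Set
  Extension = Σ (Counted (Shaped κ σ) n) λ s → Slot σ (proj₁ s)

  extend : Extension → Counted (Shaped κ σ) (suc n)
  extend ((t , pf) , p) =
    let labelled , mc , shaped = isLT∧-elim t pf ; below = Labelled⇒Below t labelled in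
    graft t v , isLT∧-intro (graft t v) (Labelled-graft t v labelled)
                            (subst T (sym (minCond-graft t v below)) mc)
                            (subst T (sym (Shaped-graft σ t p below)) shaped)
    where
    v : Vertex t
    v = slotVertex σ t p

  extend-injective : ∀ {x y} → extend x ≡ extend y → x ≡ y
  extend-injective {(t , pf) , p} {(t′ , pf′) , p′} eq
    with graft-slot-injective σ p p′ (Labelled⇒Below t (proj₁ (isLT∧-elim t pf)))
                                     (Labelled⇒Below t′ (proj₁ (isLT∧-elim t′ pf′))) (cong proj₁ eq)
  ... | refl = cong (λ pf → (t , pf) , p) (T-irrelevant pf pf′)

  extend-graft : ∀ t v → Below t → (pf : T (isLT (suc n) (graft t v) ∧ Shaped κ σ (graft t v))) →
                 Σ Extension λ x → extend x ≡ (graft t v , pf)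
  extend-graft t v below pf with isLT∧-elim (graft t v) pf
  ... | labelled , mc , shaped with graft-slot σ t v below shaped
  ... | p , refl =
    ((t , isLT∧-intro t (Labelled-prune t v labelled) (subst T (minCond-graft t v below) mc)
                        (subst T (Shaped-graft σ t p below) shaped)) , p)
    , Counted-≡ refl

  extend-surjective : 1 ≤ n → ∀ y → Σ Extension λ x → extend x ≡ y
  extend-surjective 1≤n (leaf x , pf) = ⊥-elim (<-irrefl (proj₁ (proj₁ (isLT∧-elim (leaf x) pf))) (s≤s 1≤n))
  extend-surjective 1≤n (node c A B , pf) =
    let labelled , mc , shaped = isLT∧-elim (node c A B) pf
        unique , bounded = Labelled⇒Unique×bounded (node c A B) labelled
        t , v , eq , below = prune {σ} c A B shaped mc unique bounded (proj₂ labelled n ≤-refl)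
        x , x↦ = extend-graft t v below (subst (λ X → T (isLT (suc n) X ∧ Shaped κ σ X)) (sym eq) pf)
    in x , trans x↦ (Counted-≡ eq)

  extend-bijection : 1 ≤ n → Extension ↔ Counted (Shaped κ σ) (suc n)
  extend-bijection 1≤n = ⤖⇒↔ (mk⤖ (extend-injective , strictlySurjective⇒surjective (extend-surjective 1≤n)))

  Extension↔×Fin : Extension ↔ (Counted (Shaped κ σ) n × Fin n)
  Extension↔×Fin = Σ-↔ ↔-refl (λ {s} → slots s)
    where
    slots : ∀ s → Slot σ (proj₁ s) ↔ Fin n
    slots (t , pf) = let labelled , _ , shaped = isLT∧-elim t pf in
                     subst (λ k → Slot σ t ↔ Fin k) (proj₁ labelled) (Slot-count κ σ t shaped)

Labelled-1 : ∀ t → Labelled 1 t → t ≡ leaf 1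
Labelled-1 (leaf x) (_ , cover) with cover 0 (s≤s z≤n)
... | here refl = refl
Labelled-1 (node c A B) (size≡1 , _) = ⊥-elim (<-irrefl (sym size≡1) (+-mono-≤ (1≤size A) (1≤size B)))

Counted-1 : ∀ {p} → T (p (leaf 1)) → Fin 1 ↔ Counted p 1
Counted-1 p1 = ↔-trans 1↔⊤ (mk↔ₛ′ (λ _ → leaf 1 , p1) (λ _ → tt)
  (λ (t , pf) → Counted-≡ (sym (Labelled-1 t (proj₁ (isLT∧-elim t pf))))) (λ _ → refl))

Shaped-count : ∀ κ σ n → Fin (n !) ↔ Counted (Shaped κ σ) (suc n)
Shaped-count κ σ zero = Counted-1 tt
Shaped-count κ σ (suc n) = begin
  Fin (suc n * n !)                                ↔⟨ *↔× ⟩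
  (Fin (suc n) × Fin (n !))                        ↔⟨ ↔-refl ×-↔ Shaped-count κ σ n ⟩
  (Fin (suc n) × Counted (Shaped κ σ) (suc n))     ↔⟨ ×-comm _ _ ⟩
  (Counted (Shaped κ σ) (suc n) × Fin (suc n))     ↔⟨ Extension↔×Fin ⟨
  Extension                                        ↔⟨ extend-bijection (s≤s z≤n) ⟩
  Counted (Shaped κ σ) (suc (suc n))               ∎
  where
  open Growth κ σ (suc n)
  open EquationalReasoning

Counted-0 : ∀ {p} → Fin 0 ↔ Counted p 0
Counted-0 = mk↔ₛ′ (λ ()) (λ y → ⊥-elim (empty y)) (λ y → ⊥-elim (empty y)) (λ ())
  where
  empty : ∀ {p} → Counted p 0 → ⊥
  empty (t , pf) = <-irrefl (sym (proj₁ (proj₁ (isLT∧-elim t pf)))) (1≤size t)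

Labelled-2 : ∀ t → Labelled 2 t → T (minCond t) → Σ Col λ c → t ≡ node c l1 l2
Labelled-2 (leaf x) (size≡2 , _) _ = ⊥-elim (<-irrefl size≡2 (s≤s (s≤s z≤n)))
Labelled-2 (node c (node d X Y) B) (size≡2 , _) _ =
  ⊥-elim (<-irrefl (sym size≡2) (+-mono-≤ (+-mono-≤ (1≤size X) (1≤size Y)) (1≤size B)))
Labelled-2 (node c (leaf a) (node e X Y)) (size≡2 , _) _ =
  ⊥-elim (<-irrefl (sym size≡2) (s≤s (+-mono-≤ (1≤size X) (1≤size Y))))
Labelled-2 (node c (leaf a) (leaf b)) (_ , cover) mc
  with cover 0 (s≤s z≤n) | cover 1 (s≤s (s≤s z≤n)) | proj₁ (minCond-node {c} {leaf a} {leaf b} mc)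
... | here refl | there (here refl) | _ = c , refl
... | there (here refl) | here refl | s≤s ()
... | there (here refl) | there (here ()) | _

Counted-2 : ∀ {p} → T (p (node ∘ l1 l2)) → T (p (node • l1 l2)) → Fin 2 ↔ Counted p 2
Counted-2 {p} p∘ p• = mk↔ₛ′ to from to∘from from∘to
  where
  to : Fin 2 → Counted p 2
  to 0F = node ∘ l1 l2 , p∘
  to 1F = node • l1 l2 , p•
  index : Col → Fin 2
  index ∘ = 0F
  index • = 1F
  rootColour : ∀ y → Σ Col λ c → proj₁ y ≡ node c l1 l2
  rootColour (t , pf) = let labelled , mc , _ = isLT∧-elim t pf in Labelled-2 t labelled mc
  from : Counted p 2 → Fin 2
  from y = index (proj₁ (rootColour y))
  to∘from : ∀ y → to (from y) ≡ y
  to∘from y with rootColour y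
  ... | ∘ , t≡ = Counted-≡ (sym t≡)
  ... | • , t≡ = Counted-≡ (sym t≡)
  from∘to : ∀ x → from (to x) ≡ x
  from∘to 0F = refl
  from∘to 1F = refl

avoiders↔Shaped : ∀ i n → 3 ≤ n → Counted (avoids (sixSets i)) n ↔ Counted (Shaped (colourOf i) (excludedOf i)) n
avoiders↔Shaped i n 3≤n = Counted-cong λ t lt →
  let labels , mc = T-∧⁻ {labelsAre n t} lt ; labelled = labelsAre⇒Labelled n t labels in
  avoids⇔Shaped i t mc (proj₁ (Labelled⇒Unique×bounded t labelled)) (subst (3 ≤_) (sym (proj₁ labelled)) 3≤n)

avoiders-count : ∀ i n → 3 ≤ n → HasCount (sixSets i) n ((n ∸ 1) !)
avoiders-count i (suc n) 3≤n =
  ↔-trans (Shaped-count (colourOf i) (excludedOf i) n) (↔-sym (avoiders↔Shaped i (suc n) 3≤n))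

avoids-cherry : ∀ i c → T (avoids (sixSets i) (node c l1 l2))
avoids-cherry i c = subst T (sym (avoids≡forksOk (node c l1 l2))) tt
  where open ThreeLeafPatterns (sixSets i) (sixSets-threeLeaved i)

mainTheorem14 : (∀ (i j : Fin 6) → WilfEquivalent (sixSets i) (sixSets j))
    × (∀ (i : Fin 6) (n : ℕ) → 4 ≤ n → HasCount (sixSets i) n ((n ∸ 1) !))
mainTheorem14 = wilf , λ i n 4≤n → avoiders-count i n (≤-trans (n≤1+n 3) 4≤n)
  where
  wilf : ∀ i j → WilfEquivalent (sixSets i) (sixSets j)
  wilf i j 0 = 0 , Counted-0 , Counted-0
  wilf i j 1 = 1 , Counted-1 tt , Counted-1 tt
  wilf i j 2 = 2 , Counted-2 (avoids-cherry i ∘) (avoids-cherry i •) , Counted-2 (avoids-cherry j ∘) (avoids-cherry j •)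
  wilf i j (suc (suc (suc n))) = (2 + n) ! , avoiders-count i (3 + n) 3≤3+n , avoiders-count j (3 + n) 3≤3+n
    where
    3≤3+n : 3 ≤ 3 + n
    3≤3+n = m≤m+n 3 n
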